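{- Let $k_1,k_2,\ell_1,\ell_2,b,n_1,n_2$ be positive integers with $k_1,k_2,\ell_1,\ell_2\leq b$, $4b<n_1$, $4b<n_2$. For $i=1,2$ let $\mathcal{R}_i$ be a family of $k_i\times\ell_i$ rectangles in $\mathbb{Z}_{n_1}\times\mathbb{Z}_{n_2}$, and suppose $\mathcal{R}=\mathcal{R}_1\cup\mathcal{R}_2$ is proj-intersecting. Then $\mathcal{R}$ cannot simultaneously contain a $b$-blocking pair with base in $\mathbb{Z}_{n_2}$, i.e. two rectangles $I_1\times J_0,\ I_2\times J_0$ with $d(I_1,I_2)\geq b+1$, and a $b$-blocking pair with base in $\mathbb{Z}_{n_1}$, i.e. two rectangles $I_0\times J_3,\ I_0\times J_4$ with $d(J_3,J_4)\geq b+1$.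
   Context: For $u,v\in\mathbb{Z}_n$ the distance $d(u,v)$ is the smaller of $(u-v)\bmod n$ and $(v-u)\bmod n$. An interval of length $a$ in $\mathbb{Z}_n$ is a set $\{i+1,\ldots,i+a\}$ (mod $n$); the distance of two intervals is the minimum distance between an element of one and an element of the other. A $k\times\ell$ rectangle is $I\times J$ with $I$ an interval of length $k$ in $\mathbb{Z}_{n_1}$ and $J$ an interval of length $\ell$ in $\mathbb{Z}_{n_2}$. Rectangles $I\times J$, $I'\times J'$ are proj-intersecting if $I\cap I'\neq\emptyset$ or $J\cap J'\neq\emptyset$; a family is proj-intersecting if every two members are. -}

module Defs where

open import Data.Nat using (ℕ; zero; suc; _+_; _∸_; _≤_; _⊓_; _%_)
open import Data.Fin using (Fin; toℕ)
open import Data.Product using (Σ; ∃; _×_; _,_)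
open import Data.Sum using (_⊎_)
open import Relation.Binary.PropositionalEquality using (_≡_)

-- reduction modulo n (the case n = 0 never arises below since n > 4b ≥ 4)
_mod_ : ℕ → ℕ → ℕ
x mod zero    = x
x mod (suc m) = x % suc m

cdiff : (n : ℕ) → Fin n → Fin n → ℕ
cdiff n u v = (n + toℕ u ∸ toℕ v) mod n

dist : (n : ℕ) → Fin n → Fin n → ℕ
dist n u v = cdiff n u v ⊓ cdiff n v u

-- the interval {i+1, ..., i+a} (mod n), given by i and its length a
record Interval (n : ℕ) : Set where
  constructor interval
  field
    start : Fin n
    len   : ℕ
open Interval public

_∈I_ : {n : ℕ} → Fin n → Interval n → Set
_∈I_ {n} u I = ∃ λ t → 1 ≤ t × t ≤ len I × toℕ u ≡ (toℕ (start I) + t) mod n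

Meet : {n : ℕ} → Interval n → Interval n → Set
Meet {n} I I' = Σ (Fin n) λ u → u ∈I I × u ∈I I'

DistGE : {n : ℕ} → Interval n → Interval n → ℕ → Set
DistGE {n} I I' m = ∀ u v → u ∈I I → v ∈I I' → m ≤ dist n u v

record Rect (n₁ n₂ : ℕ) : Set where
  constructor _⊠_
  field
    fst : Interval n₁
    snd : Interval n₂
open Rect public

HasShape : {n₁ n₂ : ℕ} → Rect n₁ n₂ → ℕ → ℕ → Set
HasShape R k ℓ = len (fst R) ≡ k × len (snd R) ≡ ℓ

Family : ℕ → ℕ → Set₁
Family n₁ n₂ = Rect n₁ n₂ → Set

_∪F_ : {n₁ n₂ : ℕ} → Family n₁ n₂ → Family n₁ n₂ → Family n₁ n₂
(F ∪F G) R = F R ⊎ G R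

ProjIntersecting : {n₁ n₂ : ℕ} → Rect n₁ n₂ → Rect n₁ n₂ → Set
ProjIntersecting R R' = Meet (fst R) (fst R') ⊎ Meet (snd R) (snd R')

ProjIntersectingFamily : {n₁ n₂ : ℕ} → Family n₁ n₂ → Set
ProjIntersectingFamily F = ∀ R R' → F R → F R' → ProjIntersecting R R'

BlockingPair₂ : {n₁ n₂ : ℕ} → ℕ → Family n₁ n₂ → Set
BlockingPair₂ {n₁} {n₂} b F =
  Σ (Interval n₁) λ I₁ → Σ (Interval n₁) λ I₂ → Σ (Interval n₂) λ J₀ →
    F (I₁ ⊠ J₀) × F (I₂ ⊠ J₀) × DistGE I₁ I₂ (suc b)

BlockingPair₁ : {n₁ n₂ : ℕ} → ℕ → Family n₁ n₂ → Set
BlockingPair₁ {n₁} {n₂} b F =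
  Σ (Interval n₁) λ I₀ → Σ (Interval n₂) λ J₃ → Σ (Interval n₂) λ J₄ →
    F (I₀ ⊠ J₃) × F (I₀ ⊠ J₄) × DistGE J₃ J₄ (suc b)

-- An interval of length at most b has diameter at most b, so it cannot meet two
-- intervals at distance at least b + 1.  Every rectangle of a blocking pair with
-- base in Z_{n₂} must proj-intersect I₀ × J₃; the first factors I₁, I₂ cannot both
-- meet I₀, so J₀ meets J₃, and likewise J₀ meets J₄, contradicting d(J₃,J₄) ≥ b + 1.
module Submission where

open import Defs
open import Data.Nat using (ℕ; suc; _+_; _∸_; _*_; _/_; _%_; _≤_; _<_; NonZero)
open import Data.Nat.Properties
open import Data.Nat.DivMod using (m≡m%n+[m/n]*n; m%n%n≡m%n; [m+kn]%n≡m%n; m%n≤n; m%n≤m; %-distribˡ-+)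
open import Data.Empty using (⊥; ⊥-elim)
open import Data.Nat.Solver using (module +-*-Solver)
open import Data.Fin using (Fin; toℕ)
open import Data.Product using (_×_; _,_; proj₁; proj₂)
open import Data.Sum using (inj₁; inj₂)
open import Relation.Nullary using (¬_)
open import Relation.Binary.PropositionalEquality

[m+n%d]%d≡[m+n]%d : ∀ m n d .{{_ : NonZero d}} → (m + n % d) % d ≡ (m + n) % d
[m+n%d]%d≡[m+n]%d m n d = begin
  (m + n % d) % d           ≡⟨ %-distribˡ-+ m (n % d) d ⟩
  (m % d + n % d % d) % d   ≡⟨ cong (λ r → (m % d + r) % d) (m%n%n≡m%n n d) ⟩
  (m % d + n % d) % d       ≡⟨ %-distribˡ-+ m n d ⟨
  (m + n) % d               ∎
  where open ≡-Reasoning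

[n+[x+d]%n∸x%n]%n≡d%n : ∀ n .{{_ : NonZero n}} x d → (n + (x + d) % n ∸ x % n) % n ≡ d % n
[n+[x+d]%n∸x%n]%n≡d%n n x d = begin
  (n + (x + d) % n ∸ x % n) % n   ≡⟨ cong (_% n) (+-∸-comm ((x + d) % n) (m%n≤n x n)) ⟩
  (n ∸ x % n + (x + d) % n) % n   ≡⟨ [m+n%d]%d≡[m+n]%d (n ∸ x % n) (x + d) n ⟩
  (n ∸ x % n + (x + d)) % n       ≡⟨ cong (_% n) complement ⟩
  (d + suc (x / n) * n) % n       ≡⟨ [m+kn]%n≡m%n d (suc (x / n)) n ⟩
  d % n                           ∎
  where
  open ≡-Reasoning
  open +-*-Solver
  complement : n ∸ x % n + (x + d) ≡ d + suc (x / n) * n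
  complement = begin
    n ∸ x % n + (x + d)                     ≡⟨ cong (λ y → n ∸ x % n + (y + d)) (m≡m%n+[m/n]*n x n) ⟩
    n ∸ x % n + (x % n + x / n * n + d)     ≡⟨ solve 4 (λ p a r e → p :+ (a :+ r :+ e) := e :+ (p :+ a :+ r))
                                                   refl (n ∸ x % n) (x % n) (x / n * n) d ⟩
    d + (n ∸ x % n + x % n + x / n * n)     ≡⟨ cong (λ y → d + (y + x / n * n)) (m∸n+n≡m (m%n≤n x n)) ⟩
    d + suc (x / n) * n                     ∎

cdiff-shift≤ : ∀ {n} (u v : Fin n) s {t t'} → t ≤ t' →
               toℕ u ≡ (s + t') mod n → toℕ v ≡ (s + t) mod n → cdiff n u v ≤ t' ∸ t
cdiff-shift≤ {suc m} u v s {t} {t'} t≤t' u≡ v≡ = begin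
  cdiff n u v                                   ≡⟨ cong₂ (λ p q → (n + p ∸ q) % n) u≡ v≡ ⟩
  (n + (s + t') % n ∸ (s + t) % n) % n          ≡⟨ cong (λ y → (n + y % n ∸ (s + t) % n) % n) s+t'≡ ⟩
  (n + (s + t + (t' ∸ t)) % n ∸ (s + t) % n) % n ≡⟨ [n+[x+d]%n∸x%n]%n≡d%n n (s + t) (t' ∸ t) ⟩
  (t' ∸ t) % n                                  ≤⟨ m%n≤m (t' ∸ t) n ⟩
  t' ∸ t                                        ∎
  where
  open ≤-Reasoning
  n = suc m
  s+t'≡ : s + t' ≡ s + t + (t' ∸ t)
  s+t'≡ = trans (cong (s +_) (sym (m+[n∸m]≡n t≤t'))) (sym (+-assoc s t (t' ∸ t)))

∈I-dist≤len : ∀ {n} {I : Interval n} {u v : Fin n} → u ∈I I → v ∈I I → dist n u v ≤ len I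
∈I-dist≤len {n} {I} {u} {v} (t , _ , t≤ , u≡) (t' , _ , t'≤ , v≡) with ≤-total t t'
... | inj₁ t≤t' = begin
  dist n u v   ≤⟨ m⊓n≤n (cdiff n u v) (cdiff n v u) ⟩
  cdiff n v u  ≤⟨ cdiff-shift≤ v u (toℕ (start I)) t≤t' v≡ u≡ ⟩
  t' ∸ t       ≤⟨ m∸n≤m t' t ⟩
  t'           ≤⟨ t'≤ ⟩
  len I        ∎
  where open ≤-Reasoning hiding (start)
... | inj₂ t'≤t = begin
  dist n u v   ≤⟨ m⊓n≤m (cdiff n u v) (cdiff n v u) ⟩
  cdiff n u v  ≤⟨ cdiff-shift≤ u v (toℕ (start I)) t'≤t u≡ v≡ ⟩
  t ∸ t'       ≤⟨ m∸n≤m t t' ⟩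
  t            ≤⟨ t≤ ⟩
  len I        ∎
  where open ≤-Reasoning hiding (start)

Meet-sym : ∀ {n} {I I' : Interval n} → Meet I I' → Meet I' I
Meet-sym (u , u∈I , u∈I') = u , u∈I' , u∈I

¬Meet-separated : ∀ {n b} {I X Y : Interval n} → len I ≤ b → DistGE X Y (suc b) →
                  Meet X I → Meet Y I → ⊥
¬Meet-separated {I = I} lenI≤b X⋯Y (u , u∈X , u∈I) (v , v∈Y , v∈I) =
  <-irrefl refl (≤-trans (X⋯Y u v u∈X v∈Y) (≤-trans (∈I-dist≤len u∈I v∈I) lenI≤b))

ProjIntersecting⇒Meet-snd : ∀ {n₁ n₂} {I₁ I₂ I₀ : Interval n₁} {J J' : Interval n₂} →
  (Meet I₁ I₀ → Meet I₂ I₀ → ⊥) →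
  ProjIntersecting (I₁ ⊠ J) (I₀ ⊠ J') → ProjIntersecting (I₂ ⊠ J) (I₀ ⊠ J') → Meet J J'
ProjIntersecting⇒Meet-snd ¬both (inj₁ I₁I₀) (inj₁ I₂I₀) = ⊥-elim (¬both I₁I₀ I₂I₀)
ProjIntersecting⇒Meet-snd ¬both (inj₂ JJ')  _           = JJ'
ProjIntersecting⇒Meet-snd ¬both (inj₁ _)    (inj₂ JJ')  = JJ'

¬BlockingPairs : ∀ {n₁ n₂} b (F : Family n₁ n₂) →
  (∀ R → F R → len (fst R) ≤ b × len (snd R) ≤ b) →
  ProjIntersectingFamily F → ¬ (BlockingPair₂ b F × BlockingPair₁ b F)
¬BlockingPairs b F lens≤b proj-int
  ((I₁ , I₂ , J₀ , I₁J₀∈F , I₂J₀∈F , I₁⋯I₂) , (I₀ , J₃ , J₄ , I₀J₃∈F , I₀J₄∈F , J₃⋯J₄)) =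
  ¬Meet-separated |J₀|≤b J₃⋯J₄ (Meet-sym (J₀-meets I₀J₃∈F)) (Meet-sym (J₀-meets I₀J₄∈F))
  where
  |J₀|≤b : len J₀ ≤ b
  |J₀|≤b = proj₂ (lens≤b _ I₁J₀∈F)
  J₀-meets : ∀ {J} → F (I₀ ⊠ J) → Meet J₀ J
  J₀-meets I₀J∈F = ProjIntersecting⇒Meet-snd
    (¬Meet-separated (proj₁ (lens≤b _ I₀J∈F)) I₁⋯I₂)
    (proj-int _ _ I₁J₀∈F I₀J∈F) (proj-int _ _ I₂J₀∈F I₀J∈F)

lemma7 : (k₁ k₂ ℓ₁ ℓ₂ b n₁ n₂ : ℕ) →
    1 ≤ k₁ → 1 ≤ k₂ → 1 ≤ ℓ₁ → 1 ≤ ℓ₂ → 1 ≤ b → 1 ≤ n₁ → 1 ≤ n₂ →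
    k₁ ≤ b → k₂ ≤ b → ℓ₁ ≤ b → ℓ₂ ≤ b → 4 * b < n₁ → 4 * b < n₂ →
    (R₁ R₂ : Family n₁ n₂) →
    (∀ R → R₁ R → HasShape R k₁ ℓ₁) →
    (∀ R → R₂ R → HasShape R k₂ ℓ₂) →
    ProjIntersectingFamily (R₁ ∪F R₂) →
    ¬ (BlockingPair₂ b (R₁ ∪F R₂) × BlockingPair₁ b (R₁ ∪F R₂))
lemma7 k₁ k₂ ℓ₁ ℓ₂ b n₁ n₂ _ _ _ _ _ _ _ k₁≤b k₂≤b ℓ₁≤b ℓ₂≤b _ _ R₁ R₂ shape₁ shape₂ =
  ¬BlockingPairs b (R₁ ∪F R₂) lens≤b
  where
  lens≤b : ∀ R → (R₁ ∪F R₂) R → len (fst R) ≤ b × len (snd R) ≤ b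
  lens≤b R (inj₁ R∈R₁) with shape₁ R R∈R₁
  ... | |I|≡k₁ , |J|≡ℓ₁ = subst (_≤ b) (sym |I|≡k₁) k₁≤b , subst (_≤ b) (sym |J|≡ℓ₁) ℓ₁≤b
  lens≤b R (inj₂ R∈R₂) with shape₂ R R∈R₂
  ... | |I|≡k₂ , |J|≡ℓ₂ = subst (_≤ b) (sym |I|≡k₂) k₂≤b , subst (_≤ b) (sym |J|≡ℓ₂) ℓ₂≤b
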